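{- Fix $q,t\in\mathbb{K}$. For each graph $G$, let $\mathbf{S\Sigma}[G]\subseteq\boldsymbol{\Sigma}[G]$ be the span of the stable compositions of $G$. Then $\mathbf{S\Sigma}_{q,t}$ is a Hopf submonoid of the $(q,t)$-Hopf monoid $\boldsymbol{\Sigma}_{q,t}$, i.e. the product, coproduct and antipode of $\boldsymbol{\Sigma}_{q,t}$ restrict to $\mathbf{S\Sigma}$ and make it a $(q,t)$-Hopf monoid.
   Context: All graphs are finite simple graphs over a field $\mathbb{K}$; $G_S$ is the induced subgraph on $S\subseteq V(G)$, $\overline{G}$ the complement graph, $e(G,S,T)$ the number of edges of $G$ between $S$ and $T$. A $(q,t)$-Hopf monoid is a Hopf monoid in graphical species (functors from finite graphs with isomorphisms to $\mathbb{K}$-vector spaces) with the Cauchy product $(\mathbf{g}\cdot\mathbf{h})[G]=\bigoplus_{S|T\models V(G)}\mathbf{g}[G_S]\otimes\mathbf{h}[G_T]$ (sum over ordered pairs of disjoint possibly empty sets with union $V(G)$) and braiding $x\otimes y\mapsto q^{e(G,S,T)}t^{e(\overline{G},S,T)}y\otimes x$ on the $(S,T)$ summand. $\boldsymbol{\Sigma}[G]$ has basis the set compositions $C=C_1|\cdots|C_k$ of $V(G)$ (sequences of nonempty disjoint blocks with union $V(G)$). The $(q,t)$-Hopf monoid $\boldsymbol{\Sigma}_{q,t}$ has product $C\otimes C'\mapsto C\cdot C'$ (concatenation) and coproduct $\Delta_G^{S,T}(C)=q^{\mathrm{inv}_{S,T}(C,G)}t^{\mathrm{inv}_{S,T}(C,\overline{G})}C_S\otimes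 C_T$, where $C_S$ is obtained from $C_1\cap S|\cdots|C_k\cap S$ by deleting empty blocks, and $\mathrm{inv}_{S,T}(C,G)$ is the number of edges $st\in E(G)$ with $s\in S$, $t\in T$, $s\in C_j$, $t\in C_i$, $j>i$. A stable composition of $G$ is a composition $C_1|\cdots|C_k$ of $V(G)$ such that each $G_{C_i}$ has no edges. -}

module Defs where

open import Level using (Level; _⊔_; suc)
open import Algebra.Bundles using (CommutativeRing)
open import Data.Bool using (Bool; true; false; not; _∧_; if_then_else_)
open import Data.Nat as ℕ using (ℕ; zero; _<ᵇ_; _≡ᵇ_)
open import Data.List using (List; []; _∷_; _++_; map; concat; concatMap; filter; foldr; length)
open import Data.List.Properties using (≡-dec)
open import Data.List.Relation.Unary.All using (All)
open import Data.List.Relation.Unary.Linked using (Linked)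
open import Data.List.Membership.Propositional using (_∈_)
open import Data.List.Membership.DecPropositional ℕ._≟_ using (_∈?_)
open import Data.List.Relation.Binary.Permutation.Propositional using (_↭_)
open import Data.Product using (_×_; _,_; Σ)
open import Relation.Nullary using (¬_; does)
open import Relation.Binary.PropositionalEquality using (_≡_; _≢_)

record Field (c ℓ : Level) : Set (suc (c ⊔ ℓ)) where
  field
    commutativeRing : CommutativeRing c ℓ
  open CommutativeRing commutativeRing public
  field
    1≉0     : ¬ (1# ≈ 0#)
    inverse : ∀ x → ¬ (x ≈ 0#) → Σ Carrier λ y → (x * y) ≈ 1#

-- Vertices are natural numbers (every finite graph
-- is isomorphic to one of this form).

record Graph : Set where
  constructor graph
  field
    V   : List ℕ
    adj : ℕ → ℕ → Bool
open Graph public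

WellFormed : Graph → Set
WellFormed G = Linked ℕ._<_ (V G)
             × (∀ x y → adj G x y ≡ adj G y x)
             × (∀ x → adj G x x ≡ false)

induced : Graph → List ℕ → Graph
induced G S = graph S (adj G)

complement : Graph → Graph
complement G = graph (V G) (λ x y → if x ≡ᵇ y then false else not (adj G x y))

-- Set compositions, represented canonically as lists of blocks, each
-- block a strictly increasing (hence duplicate-free) nonempty list.

Comp : Set
Comp = List (List ℕ)

IsComposition : List ℕ → Comp → Set
IsComposition W C = All (λ B → B ≢ []) C
                  × All (Linked ℕ._<_) C
                  × (concat C ↭ W)

Independent : Graph → List ℕ → Set
Independent G B = ∀ x y → x ∈ B → y ∈ B → adj G x y ≡ false

Stable : Graph → Comp → Set
Stable G C = IsComposition (V G) C × All (Independent G) C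

dropEmpty : Comp → Comp
dropEmpty []             = []
dropEmpty ([] ∷ C)       = dropEmpty C
dropEmpty ((x ∷ B) ∷ C)  = (x ∷ B) ∷ dropEmpty C

restrict : List ℕ → Comp → Comp
restrict S C = dropEmpty (map (filter (_∈? S)) C)

-- all ordered decompositions S|T of a vertex list (S, T disjoint, possibly
-- empty, union = the list), with S and T listed in the order of the list
splits : List ℕ → List (List ℕ × List ℕ)
splits []       = ([] , []) ∷ []
splits (x ∷ xs) = concatMap (λ { (S , T) → (x ∷ S , T) ∷ (S , x ∷ T) ∷ [] }) (splits xs)

blockIndex : Comp → ℕ → ℕ
blockIndex []      v = zero
blockIndex (B ∷ C) v = if does (v ∈? B) then zero else ℕ.suc (blockIndex C v)

count : ∀ {a} {A : Set a} → (A → Bool) → List A → ℕ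
count p []       = zero
count p (x ∷ xs) = if p x then ℕ.suc (count p xs) else count p xs

inv : Graph → List ℕ → List ℕ → Comp → ℕ
inv G S T C = count (λ { (s , t) → adj G s t ∧ (blockIndex C t <ᵇ blockIndex C s) })
                    (concatMap (λ s → map (λ t → (s , t)) T) S)

-- The (q,t)-Hopf monoid Σ_{q,t} over a field, on the level of formal
-- linear combinations of basis elements.

module HopfΣ {c ℓ} (F : Field c ℓ) (q t : Field.Carrier F) where
  open Field F

  _^_ : Carrier → ℕ → Carrier
  x ^ zero    = 1#
  x ^ ℕ.suc n = x * (x ^ n)

  FC : Set c
  FC = List (Carrier × Comp)

  coeff : Comp → FC → Carrier
  coeff D []             = 0#
  coeff D ((k , E) ∷ xs) = if does (≡-dec (≡-dec ℕ._≟_) E D) then k + coeff D xs else coeff D xs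

  _≋_ : FC → FC → Set ℓ
  x ≋ y = ∀ D → coeff D x ≈ coeff D y

  -- coproduct coefficient q^{inv(C,G)} t^{inv(C, Ḡ)} of Δ_G^{S,T}(C)
  Δcoeff : Graph → List ℕ → List ℕ → Comp → Carrier
  Δcoeff G S T C = (q ^ inv G S T C) * (t ^ inv (complement G) S T C)

  -- μ ∘ (s ⊗ id) ∘ Δ  and  μ ∘ (id ⊗ s) ∘ Δ  on the basis element C of Σ[G]
  -- (product = concatenation of compositions)
  μ∘s⊗id∘Δ : (Graph → Comp → FC) → Graph → Comp → FC
  μ∘s⊗id∘Δ s G C = concatMap
    (λ { (S , T) → map (λ { (k , A) → (Δcoeff G S T C * k , A ++ restrict T C) })
                       (s (induced G S) (restrict S C)) })
    (splits (V G))

  μ∘id⊗s∘Δ : (Graph → Comp → FC) → Graph → Comp → FC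
  μ∘id⊗s∘Δ s G C = concatMap
    (λ { (S , T) → map (λ { (k , B) → (Δcoeff G S T C * k , restrict S C ++ B) })
                       (s (induced G T) (restrict T C)) })
    (splits (V G))

  η∘ε : Graph → FC
  η∘ε (graph [] _)      = (1# , []) ∷ []
  η∘ε (graph (_ ∷ _) _) = []

  -- s is an antipode of Σ_{q,t} (given on basis elements, extended linearly)
  IsAntipode : (Graph → Comp → FC) → Set ℓ
  IsAntipode s = ∀ G → WellFormed G → ∀ C → IsComposition (V G) C →
                   (μ∘s⊗id∘Δ s G C ≋ η∘ε G) × (μ∘id⊗s∘Δ s G C ≋ η∘ε G)

  InSΣ : Graph → FC → Set ℓ
  InSΣ G x = ∀ D → ¬ Stable G D → coeff D x ≈ 0#

ProductClosed : Set
ProductClosed = ∀ G → WellFormed G → ∀ S T → (S , T) ∈ splits (V G) →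
  ∀ A B → Stable (induced G S) A → Stable (induced G T) B → Stable G (A ++ B)

-- coproduct: Δ_G^{S,T}(C) = (scalar) C_S ⊗ C_T maps SΣ into SΣ ⊗ SΣ
CoproductClosed : Set
CoproductClosed = ∀ G → WellFormed G → ∀ S T → (S , T) ∈ splits (V G) →
  ∀ C → Stable G C → Stable (induced G S) (restrict S C) × Stable (induced G T) (restrict T C)

AntipodeClosed : ∀ {c ℓ} (F : Field c ℓ) (q t : Field.Carrier F) → Set (c ⊔ ℓ)
AntipodeClosed F q t = ∀ (s : Graph → Comp → FC) → IsAntipode s →
  ∀ G → WellFormed G → ∀ C → Stable G C → InSΣ G (s G C)
  where open HopfΣ F q t

-- Stability is a blockwise condition. Restricting a composition to S only shrinks its
-- blocks, and the blocks of a product C · C' are blocks of C or of C', independent in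
-- the induced subgraphs G_S and G_T and hence in G; so product and coproduct preserve
-- stability. For an antipode s, the relation μ ∘ (s ⊗ id) ∘ Δ = η ∘ ε contains s(C) as
-- its (S, T) = (V, ∅) term, every other term being a multiple of s(C_S) · C_T with
-- |S| < |V|. By induction on |V| these terms lie in SΣ, which is closed under right
-- multiplication by the stable composition C_T, and η ∘ ε(C) lies in SΣ; hence so does s(C).
module Submission where

open import Defs
open import Data.Bool using (true; false)
open import Data.Nat as ℕ using (ℕ; _<_; z<s)
open import Data.Nat.Induction using (<-wellFounded)
open import Data.Nat.Properties using (<-trans; <-irrefl; m<m+n)
open import Data.List using (List; []; _∷_; _++_; map; concat; concatMap; filter; length)
open import Data.List.Properties
  using (≡-dec; ++-monoid; ++-identityʳ; ++-cancelʳ; concat-++; filter-++; filter-accept; filter-reject;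
         filter-all; filter-none; map-id-local)
open import Data.List.Relation.Unary.All as All using (All; []; _∷_)
open import Data.List.Relation.Unary.All.Properties using (++⁺; map⁺; concat⁺)
open import Data.List.Relation.Unary.Linked using (Linked; tail)
open import Data.List.Relation.Unary.Linked.Properties using (Linked⇒AllPairs; filter⁺)
open import Data.List.Relation.Unary.AllPairs using (_∷_)
open import Data.List.Relation.Unary.Any using (here; there)
open import Data.List.Membership.Propositional using (_∈_; _∉_)
open import Data.List.Membership.Propositional.Properties using (∈-++⁺ˡ; ∈-concat⁺′; ∈-filter⁻)
open import Data.List.Membership.DecPropositional ℕ._≟_ using (_∈?_)
open import Data.List.Relation.Binary.Permutation.Propositional
  using (_↭_; ↭-refl; ↭-sym; module PermutationReasoning)
open import Data.List.Relation.Binary.Permutation.Propositional.Properties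
  using (∈-resp-↭; filter-↭)
import Data.List.Relation.Binary.Permutation.Propositional.Properties as ↭
open import Data.List.Relation.Binary.Suffix.Heterogeneous.Properties using (suffix?)
open import Data.List.Relation.Binary.Suffix.Propositional.Properties using (Suffix-as-∣ʳ; ∣ʳ-as-Suffix)
open import Data.List.Relation.Ternary.Interleaving.Propositional
  using (Interleaving; []; consˡ; consʳ; swap; toPermutation)
open import Data.List.Relation.Ternary.Interleaving.Properties using (interleave-length)
open import Data.Product using (_×_; _,_; ∃; proj₁)
open import Function using (_∘_)
open import Induction.WellFounded using (Acc; acc)
open import Relation.Nullary using (¬_; Dec; does; yes; no; contradiction)
import Relation.Nullary.Decidable as Dec
open import Relation.Binary.PropositionalEquality
  using (_≡_; _≢_; refl; sym; trans; cong; cong₂; subst; module ≡-Reasoning)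

open import Algebra.Properties.Monoid.Divisibility (++-monoid (List ℕ)) using (_∣ʳ_; _∤ʳ_; _,_)

splits-Interleaving : ∀ V → All (λ (S , T) → Interleaving S T V) (splits V)
splits-Interleaving []       = [] ∷ []
splits-Interleaving (x ∷ xs) =
  concat⁺ (map⁺ (All.map (λ i → consˡ i ∷ consʳ i ∷ []) (splits-Interleaving xs)))

splits-head : ∀ V → ∃ λ rest → splits V ≡ (V , []) ∷ rest × All (λ (_ , T) → T ≢ []) rest
splits-head []       = [] , refl , []
splits-head (x ∷ xs) with rest , splits≡ , proper ← splits-head xs rewrite splits≡ =
  _ , refl , (λ ()) ∷ concat⁺ (map⁺ (All.map (λ T≢[] → T≢[] ∷ (λ ()) ∷ []) proper))

Interleaving-length-< : ∀ {S T V : List ℕ} → Interleaving S T V → T ≢ [] → length S < length V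
Interleaving-length-< {S} {[]}    i T≢[] = contradiction refl T≢[]
Interleaving-length-< {S} {_ ∷ _} i T≢[] =
  subst (length S <_) (sym (interleave-length i)) (m<m+n (length S) z<s)

Interleaving-∈ˡ : ∀ {S T V : List ℕ} {x} → Interleaving S T V → x ∈ S → x ∈ V
Interleaving-∈ˡ i x∈S = ∈-resp-↭ (↭-sym (toPermutation i)) (∈-++⁺ˡ x∈S)

head-∉-tail : ∀ {x V} → Linked _<_ (x ∷ V) → x ∉ V
head-∉-tail l x∈V with x<V ∷ _ ← Linked⇒AllPairs <-trans l = <-irrefl refl (All.lookup x<V x∈V)

filter-∈-fresh : ∀ {x S} V → x ∉ V → filter (_∈? x ∷ S) V ≡ filter (_∈? S) V
filter-∈-fresh         []      x∉V = refl
filter-∈-fresh {x} {S} (y ∷ V) x∉V = by-cases (y ∈? S)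
  where
  open ≡-Reasoning
  by-cases : Dec (y ∈ S) → filter (_∈? x ∷ S) (y ∷ V) ≡ filter (_∈? S) (y ∷ V)
  by-cases (yes y∈S) = begin
    filter (_∈? x ∷ S) (y ∷ V) ≡⟨ filter-accept (_∈? x ∷ S) (there y∈S) ⟩
    y ∷ filter (_∈? x ∷ S) V   ≡⟨ cong (y ∷_) (filter-∈-fresh V (x∉V ∘ there)) ⟩
    y ∷ filter (_∈? S) V       ≡⟨ filter-accept (_∈? S) y∈S ⟨
    filter (_∈? S) (y ∷ V)     ∎
  by-cases (no y∉S) = begin
    filter (_∈? x ∷ S) (y ∷ V) ≡⟨ filter-reject (_∈? x ∷ S) y∉x∷S ⟩
    filter (_∈? x ∷ S) V       ≡⟨ filter-∈-fresh V (x∉V ∘ there) ⟩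
    filter (_∈? S) V           ≡⟨ filter-reject (_∈? S) y∉S ⟨
    filter (_∈? S) (y ∷ V)     ∎
    where
    y∉x∷S : y ∉ x ∷ S
    y∉x∷S (here refl) = x∉V (here refl)
    y∉x∷S (there y∈S) = y∉S y∈S

filter-∈-Interleaving : ∀ {S T V : List ℕ} → Linked _<_ V → Interleaving S T V → filter (_∈? S) V ≡ S
filter-∈-Interleaving l [] = refl
filter-∈-Interleaving {x ∷ S} {_} {x ∷ V} l (consˡ i) = begin
  filter (_∈? x ∷ S) (x ∷ V) ≡⟨ filter-accept (_∈? x ∷ S) (here refl) ⟩
  x ∷ filter (_∈? x ∷ S) V   ≡⟨ cong (x ∷_) (filter-∈-fresh V (head-∉-tail l)) ⟩
  x ∷ filter (_∈? S) V       ≡⟨ cong (x ∷_) (filter-∈-Interleaving (tail l) i) ⟩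
  x ∷ S                      ∎
  where open ≡-Reasoning
filter-∈-Interleaving {S} {_} {x ∷ V} l (consʳ i) =
  trans (filter-reject (_∈? S) (head-∉-tail l ∘ Interleaving-∈ˡ i)) (filter-∈-Interleaving (tail l) i)

Interleaving-Linkedˡ : ∀ {S T V : List ℕ} → Linked _<_ V → Interleaving S T V → Linked _<_ S
Interleaving-Linkedˡ {S} l i = subst (Linked _<_) (filter-∈-Interleaving l i) (filter⁺ (_∈? S) <-trans l)

WellFormed-induced : ∀ {G S T} → WellFormed G → Interleaving S T (V G) → WellFormed (induced G S)
WellFormed-induced (l , symmetric , irreflexive) i = Interleaving-Linkedˡ l i , symmetric , irreflexive

dropEmpty-nonempty : ∀ X → All (_≢ []) (dropEmpty X)
dropEmpty-nonempty []            = []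
dropEmpty-nonempty ([] ∷ X)      = dropEmpty-nonempty X
dropEmpty-nonempty ((x ∷ B) ∷ X) = (λ ()) ∷ dropEmpty-nonempty X

dropEmpty⁺ : ∀ {P : List ℕ → Set} {X} → All P X → All P (dropEmpty X)
dropEmpty⁺ {X = []}          []       = []
dropEmpty⁺ {X = [] ∷ X}      (_ ∷ ps) = dropEmpty⁺ ps
dropEmpty⁺ {X = (x ∷ B) ∷ X} (p ∷ ps) = p ∷ dropEmpty⁺ ps

concat-dropEmpty : ∀ X → concat (dropEmpty X) ≡ concat X
concat-dropEmpty []            = refl
concat-dropEmpty ([] ∷ X)      = concat-dropEmpty X
concat-dropEmpty ((x ∷ B) ∷ X) = cong ((x ∷ B) ++_) (concat-dropEmpty X)

dropEmpty-id : ∀ {X} → All (_≢ []) X → dropEmpty X ≡ X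
dropEmpty-id {[]}          []          = refl
dropEmpty-id {[] ∷ X}      ([]≢[] ∷ _) = contradiction refl []≢[]
dropEmpty-id {(x ∷ B) ∷ X} (_ ∷ ne)    = cong ((x ∷ B) ∷_) (dropEmpty-id ne)

concat-map-filter : ∀ S C → concat (map (filter (_∈? S)) C) ≡ filter (_∈? S) (concat C)
concat-map-filter S []      = refl
concat-map-filter S (B ∷ C) =
  trans (cong (filter (_∈? S) B ++_) (concat-map-filter S C)) (sym (filter-++ (_∈? S) B (concat C)))

IsComposition-restrict : ∀ {W C} S → IsComposition W C → IsComposition (filter (_∈? S) W) (restrict S C)
IsComposition-restrict {W} {C} S (_ , increasing , C↭W) =
  dropEmpty-nonempty (map (filter (_∈? S)) C) ,
  dropEmpty⁺ (map⁺ (All.map (filter⁺ (_∈? S) <-trans) increasing)) ,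
  subst (_↭ filter (_∈? S) W) (sym concat-restrict) (filter-↭ (_∈? S) C↭W)
  where
  concat-restrict : concat (restrict S C) ≡ filter (_∈? S) (concat C)
  concat-restrict = trans (concat-dropEmpty (map (filter (_∈? S)) C)) (concat-map-filter S C)

Independent-restrict : ∀ {G C} S → All (Independent G) C → All (Independent G) (restrict S C)
Independent-restrict {G} S independent =
  dropEmpty⁺ (map⁺ {f = filter (_∈? S)} (All.map independent-filter independent))
  where
  independent-filter : ∀ {B} → Independent G B → Independent G (filter (_∈? S) B)
  independent-filter ind x y x∈ y∈ = ind x y (proj₁ (∈-filter⁻ (_∈? S) x∈)) (proj₁ (∈-filter⁻ (_∈? S) y∈))

restrict-Stable : ∀ {G S T C} → Linked _<_ (V G) → Interleaving S T (V G) →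
                  Stable G C → Stable (induced G S) (restrict S C)
restrict-Stable {G} {S} {C = C} l i (composition , independent) =
  subst (λ W → IsComposition W (restrict S C)) (filter-∈-Interleaving l i)
        (IsComposition-restrict S composition) ,
  Independent-restrict {G} S independent

restrict-[] : ∀ C → restrict [] C ≡ []
restrict-[] []      = refl
restrict-[] (B ∷ C) rewrite filter-none (_∈? []) {B} (All.tabulate λ _ ()) = restrict-[] C

restrict-self : ∀ {W C} → IsComposition W C → restrict W C ≡ C
restrict-self {W} {C} (nonempty , _ , C↭W) =
  trans (cong dropEmpty (map-id-local {xs = C} (All.tabulate block-inside))) (dropEmpty-id nonempty)
  where
  block-inside : ∀ {B} → B ∈ C → filter (_∈? W) B ≡ B
  block-inside B∈C = filter-all (_∈? W) (All.tabulate λ x∈B → ∈-resp-↭ C↭W (∈-concat⁺′ x∈B B∈C))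

inv-[] : ∀ G S C → inv G S [] C ≡ 0
inv-[] G []      C = refl
inv-[] G (_ ∷ S) C = inv-[] G S C

productClosed : ProductClosed
productClosed G _ S T S|T A B ((neA , incA , A↭S) , indA) ((neB , incB , B↭T) , indB) =
  (++⁺ neA neB , ++⁺ incA incB , AB↭V) , ++⁺ indA indB
  where
  open PermutationReasoning
  AB↭V : concat (A ++ B) ↭ V G
  AB↭V = begin
    concat (A ++ B)      ≡⟨ concat-++ A B ⟨
    concat A ++ concat B ↭⟨ ↭.++⁺ A↭S B↭T ⟩
    S ++ T               ↭⟨ toPermutation (All.lookup (splits-Interleaving (V G)) S|T) ⟨
    V G                  ∎

coproductClosed : CoproductClosed
coproductClosed G (l , _) S T S|T C st = restrict-Stable l i st , restrict-Stable l (swap i) st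
  where i = All.lookup (splits-Interleaving (V G)) S|T

_∣ʳ?_ : (R D : Comp) → Dec (R ∣ʳ D)
R ∣ʳ? D = Dec.map′ Suffix-as-∣ʳ ∣ʳ-as-Suffix (suffix? (≡-dec ℕ._≟_) R D)

module Antipode {c ℓ} (F : Field c ℓ) (q t : Field.Carrier F) where
  open Field F renaming (refl to ≈-refl; sym to ≈-sym; trans to ≈-trans)
  open HopfΣ F q t
  open import Relation.Binary.Reasoning.Setoid setoid

  coeff-++ : ∀ D x y → coeff D (x ++ y) ≈ coeff D x + coeff D y
  coeff-++ D []            y = ≈-sym (+-identityˡ _)
  coeff-++ D ((k , E) ∷ x) y with does (≡-dec (≡-dec ℕ._≟_) E D)
  ... | true  = ≈-trans (+-congˡ (coeff-++ D x y)) (≈-sym (+-assoc _ _ _))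
  ... | false = coeff-++ D x y

  coeff-concatMap-≈0 : ∀ {A : Set} (f : A → FC) D xs → All (λ a → coeff D (f a) ≈ 0#) xs →
                       coeff D (concatMap f xs) ≈ 0#
  coeff-concatMap-≈0 f D []       []         = ≈-refl
  coeff-concatMap-≈0 f D (a ∷ xs) (fa≈0 ∷ p) = begin
    coeff D (f a ++ concatMap f xs)          ≈⟨ coeff-++ D (f a) (concatMap f xs) ⟩
    coeff D (f a) + coeff D (concatMap f xs) ≈⟨ +-cong fa≈0 (coeff-concatMap-≈0 f D xs p) ⟩
    0# + 0#                                  ≈⟨ +-identityˡ 0# ⟩
    0#                                       ∎

  mulʳ : Carrier → Comp → FC → FC
  mulʳ k R = map (λ (a , A) → (k * a , A ++ R))

  coeff-mulʳ : ∀ k R x D → coeff (D ++ R) (mulʳ k R x) ≈ k * coeff D x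
  coeff-mulʳ k R []            D = ≈-sym (zeroʳ k)
  coeff-mulʳ k R ((a , A) ∷ x) D
    with ≡-dec (≡-dec ℕ._≟_) (A ++ R) (D ++ R) | ≡-dec (≡-dec ℕ._≟_) A D
  ... | yes _     | yes _    = ≈-trans (+-congˡ (coeff-mulʳ k R x D)) (≈-sym (distribˡ k a _))
  ... | no  _     | no  _    = coeff-mulʳ k R x D
  ... | yes AR≡DR | no  A≢D  = contradiction (++-cancelʳ R A D AR≡DR) A≢D
  ... | no  AR≢DR | yes refl = contradiction refl AR≢DR

  coeff-mulʳ-∤ : ∀ k R x D → R ∤ʳ D → coeff D (mulʳ k R x) ≈ 0#
  coeff-mulʳ-∤ k R []            D R∤D = ≈-refl
  coeff-mulʳ-∤ k R ((a , A) ∷ x) D R∤D with ≡-dec (≡-dec ℕ._≟_) (A ++ R) D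
  ... | yes AR≡D = contradiction (A , AR≡D) R∤D
  ... | no  _    = coeff-mulʳ-∤ k R x D R∤D

  InSΣ-mulʳ : ∀ G → WellFormed G → ∀ S T → (S , T) ∈ splits (V G) →
              ∀ k R x → Stable (induced G T) R → InSΣ (induced G S) x → InSΣ G (mulʳ k R x)
  InSΣ-mulʳ G wf S T S|T k R x R-stable x∈SΣ D D-unstable with R ∣ʳ? D
  ... | no  R∤D         = coeff-mulʳ-∤ k R x D R∤D
  ... | yes (D′ , refl) = begin
    coeff (D′ ++ R) (mulʳ k R x) ≈⟨ coeff-mulʳ k R x D′ ⟩
    k * coeff D′ x              ≈⟨ *-congˡ (x∈SΣ D′ D′-unstable) ⟩
    k * 0#                      ≈⟨ zeroʳ k ⟩
    0#                          ∎
    where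
    D′-unstable : ¬ Stable (induced G S) D′
    D′-unstable D′-stable = D-unstable (productClosed G wf S T S|T D′ R D′-stable R-stable)

  Δcoeff-[] : ∀ G S C → Δcoeff G S [] C ≈ 1#
  Δcoeff-[] G S C = begin
    (q ^ inv G S [] C) * (t ^ inv (complement G) S [] C)
      ≡⟨ cong₂ (λ m n → (q ^ m) * (t ^ n)) (inv-[] G S C) (inv-[] (complement G) S C) ⟩
    1# * 1#
      ≈⟨ *-identityˡ 1# ⟩
    1# ∎

  η∘ε-InSΣ : ∀ G → InSΣ G (η∘ε G)
  η∘ε-InSΣ (graph (_ ∷ _) _) D D-unstable = ≈-refl
  η∘ε-InSΣ (graph []      _) D D-unstable with ≡-dec (≡-dec ℕ._≟_) [] D
  ... | yes refl = contradiction (([] , [] , ↭-refl) , []) D-unstable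
  ... | no  _    = ≈-refl

  antipode-InSΣ : ∀ s → IsAntipode s → ∀ G → WellFormed G → ∀ C → Stable G C → InSΣ G (s G C)
  antipode-InSΣ s isAntipode G = go G (<-wellFounded (length (V G)))
    where
    go : ∀ G → Acc _<_ (length (V G)) → WellFormed G → ∀ C → Stable G C → InSΣ G (s G C)
    go G (acc smaller) wf C C-stable D D-unstable with rest , splits≡ , proper ← splits-head (V G) = begin
      coeff D (s G C)                                            ≈⟨ ≈-sym head-term ⟩
      coeff D (term (V G , []))                                  ≈⟨ ≈-sym (+-identityʳ _) ⟩
      coeff D (term (V G , [])) + 0#                             ≈⟨ +-congˡ (≈-sym other-terms) ⟩
      coeff D (term (V G , [])) + coeff D (concatMap term rest)  ≈⟨ coeff-++ D (term (V G , [])) _ ⟨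
      coeff D (concatMap term ((V G , []) ∷ rest))               ≡⟨ cong (coeff D ∘ concatMap term) splits≡ ⟨
      coeff D (μ∘s⊗id∘Δ s G C)                                   ≈⟨ proj₁ (isAntipode G wf C (proj₁ C-stable)) D ⟩
      coeff D (η∘ε G)                                            ≈⟨ η∘ε-InSΣ G D D-unstable ⟩
      0#                                                         ∎
      where
      -- μ∘s⊗id∘Δ s G C is definitionally concatMap term (splits (V G)).
      term : List ℕ × List ℕ → FC
      term (S , T) = mulʳ (Δcoeff G S T C) (restrict T C) (s (induced G S) (restrict S C))

      head-term : coeff D (term (V G , [])) ≈ coeff D (s G C)
      head-term = begin
        coeff D (term (V G , []))
          ≡⟨ cong₂ (λ R C′ → coeff D (mulʳ k R (s G C′))) (restrict-[] C) (restrict-self (proj₁ C-stable)) ⟩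
        coeff D (mulʳ k [] (s G C))
          ≡⟨ cong (λ D′ → coeff D′ (mulʳ k [] (s G C))) (++-identityʳ D) ⟨
        coeff (D ++ []) (mulʳ k [] (s G C))
          ≈⟨ coeff-mulʳ k [] (s G C) D ⟩
        k * coeff D (s G C)
          ≈⟨ *-congʳ (Δcoeff-[] G (V G) C) ⟩
        1# * coeff D (s G C)
          ≈⟨ *-identityˡ _ ⟩
        coeff D (s G C) ∎
        where k = Δcoeff G (V G) [] C

      other-terms : coeff D (concatMap term rest) ≈ 0#
      other-terms = coeff-concatMap-≈0 term D rest (All.tabulate λ {(S , T)} S|T∈rest →
        let S|T = subst ((S , T) ∈_) (sym splits≡) (there S|T∈rest)
            i   = All.lookup (splits-Interleaving (V G)) S|T
            l   = proj₁ wf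
        in InSΣ-mulʳ G wf S T S|T (Δcoeff G S T C) (restrict T C) (s (induced G S) (restrict S C))
             (restrict-Stable l (swap i) C-stable)
             (go (induced G S) (smaller (Interleaving-length-< i (All.lookup proper S|T∈rest)))
                 (WellFormed-induced wf i) (restrict S C) (restrict-Stable l i C-stable))
             D D-unstable)

antipodeClosed : ∀ {c ℓ} (F : Field c ℓ) (q t : Field.Carrier F) → AntipodeClosed F q t
antipodeClosed F q t = Antipode.antipode-InSΣ F q t

mainTheorem5 : ∀ {c ℓ} (F : Field c ℓ) (q t : Field.Carrier F) →
    ProductClosed × CoproductClosed × AntipodeClosed F q t
mainTheorem5 F q t = productClosed , coproductClosed , antipodeClosed F q t
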